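{- For every integer $c\ge 1$ and every graph $G$ of treewidth $1$, we have $\alpha_c(G)\ge \frac{c}{1+c}|V(G)|$.
   Context: All graphs are finite, simple and undirected. For a graph $G=(V,E)$ and a positive integer $c$, a set $S\subseteq V$ is a $c$-clustered set if every connected component of $G[S]$ has at most $c$ vertices; $\alpha_c(G)$ is the maximum size of a $c$-clustered set in $G$. -}

module Defs where

open import Data.Nat using (ℕ; zero; suc; _+_; _*_; _≤_)
open import Data.Fin using (Fin)
open import Data.Fin.Subset using (Subset; _∈_; ∣_∣)
open import Data.Bool using (Bool; true; false; T)
open import Data.List using (List; []; _∷_; length)
open import Data.List.Relation.Unary.All using (All)
open import Data.List.Relation.Unary.Unique.Propositional using (Unique)
open import Data.Product using (Σ; ∃; _×_; _,_)
open import Relation.Binary.PropositionalEquality using (_≡_)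
open import Relation.Nullary using (¬_)

record Graph (n : ℕ) : Set where
  field
    adj   : Fin n → Fin n → Bool
    sym   : ∀ u v → adj u v ≡ adj v u
    irrefl : ∀ v → adj v v ≡ false

open Graph public

Adj : ∀ {n} → Graph n → Fin n → Fin n → Set
Adj G u v = T (adj G u v)

data WalkIn {n : ℕ} (G : Graph n) (P : Fin n → Set) : Fin n → Fin n → Set where
  here : ∀ {v} → P v → WalkIn G P v v
  step : ∀ {u v w} → P u → Adj G u v → WalkIn G P v w → WalkIn G P u w

Walk : ∀ {n} → Graph n → Fin n → Fin n → Set
Walk G = WalkIn G (λ _ → Data.Unit.⊤)
  where import Data.Unit

SameComponent : ∀ {n} → Graph n → Subset n → Fin n → Fin n → Set
SameComponent G S v u = WalkIn G (λ x → x ∈ S) v u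

-- S is c-clustered: every connected component of G[S] has at most c vertices,
-- i.e. for every v ∈ S, every duplicate-free list of vertices of the
-- component of v in G[S] has length at most c.
Clustered : ∀ {n} → ℕ → Graph n → Subset n → Set
Clustered c G S =
  ∀ v → v ∈ S → ∀ (xs : List _) → Unique xs → All (SameComponent G S v) xs →
  length xs ≤ c

data Path {n : ℕ} (G : Graph n) : Fin n → List (Fin n) → Fin n → Set where
  one  : ∀ {v} → Path G v (v ∷ []) v
  cons : ∀ {u v w xs} → Adj G u v → Path G v xs w → Path G u (u ∷ xs) w

HasCycle : ∀ {n} → Graph n → Set
HasCycle G = Σ _ λ u → Σ _ λ w → Σ (List _) λ xs →
  Path G u xs w × Unique xs × (3 ≤ length xs) × Adj G w u

Connected : ∀ {n} → Graph n → Set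
Connected G = ∀ u v → Walk G u v

IsTree : ∀ {m} → Graph (suc m) → Set
IsTree T = Connected T × ¬ HasCycle T

-- Tree decomposition of G whose bags have at most k+1 vertices,
-- i.e. of width at most k.
record TreeDecomposition {n : ℕ} (G : Graph n) (k : ℕ) : Set where
  field
    m        : ℕ
    tree     : Graph (suc m)
    isTree   : IsTree tree
    bag      : Fin (suc m) → Subset n
    cover    : ∀ v → ∃ λ t → v ∈ bag t
    edgeCov  : ∀ u v → Adj G u v → ∃ λ t → u ∈ bag t × v ∈ bag t
    subtree  : ∀ v t₁ t₂ → v ∈ bag t₁ → v ∈ bag t₂ →
               WalkIn tree (λ t → v ∈ bag t) t₁ t₂
    width≤   : ∀ t → ∣ bag t ∣ ≤ suc k

Treewidth1 : ∀ {n} → Graph n → Set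
Treewidth1 G = TreeDecomposition G 1 × ¬ TreeDecomposition G 0

-- A graph of treewidth at most 1 is 1-degenerate: every nonempty vertex set U contains a
-- vertex with at most one neighbour in U. (Prune leaves of the decomposition tree until some
-- bag holds a vertex of U that no neighbouring bag contains; its U-neighbours then share its
-- bag of size 2.) Process the vertices in such an order, so that each vertex meets at most
-- one pending neighbour: the kept vertices form clusters, each hanging below at most one
-- pending vertex. A pending vertex u is kept when the clusters attached to it have fewer
-- than c vertices in total, and deleted otherwise; a deletion closes those clusters, which
-- pays for it with at least c kept vertices. Hence c · |deleted| ≤ |kept|, i.e.
-- c n ≤ (1 + c) |kept|.

module Submission where

open import Defs hiding (sym)
open import Data.Nat using (ℕ; zero; suc; _+_; _*_; _≤_; z≤n; s≤s; _≤?_)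
open import Data.Nat.Properties
  using ( ≤-reflexive; ≤-antisym; ≤-trans; ≤-pred; ≰⇒>; 1+n≰n; m≤m+n; m≤n⇒m≤1+n
        ; +-suc; +-comm; +-mono-≤; +-monoʳ-≤; *-suc; *-zeroʳ; *-distribˡ-+; module ≤-Reasoning )
open import Data.Fin using (Fin; zero; suc; _≟_)
open import Data.Fin.Properties using (any?)
open import Data.Fin.Subset using (Subset; _∈_; ∣_∣)
open import Data.Fin.Subset.Properties using (_∈?_)
open import Data.Bool using (T; true; false; if_then_else_)
open import Data.Bool.Properties using (T?; ∧-identityʳ)
open import Data.List using (List; []; _∷_; length)
open import Data.List.Membership.Propositional using () renaming (_∈_ to _∈ₗ_)
open import Data.List.Relation.Binary.Subset.Propositional using (_⊆_)
open import Data.List.Relation.Unary.All using (All; []; _∷_)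
import Data.List.Relation.Unary.All as All
open import Data.List.Relation.Unary.All.Properties using (anti-mono; ¬Any⇒All¬)
open import Data.List.Relation.Unary.Any using (here; there)
import Data.List.Relation.Unary.Any as Any
open import Data.List.Relation.Unary.Unique.Propositional using (Unique; []; _∷_)
open import Data.Product using (Σ; ∃; ∃₂; _×_; _,_; proj₁; proj₂)
open import Data.Sum using (_⊎_; inj₁; inj₂)
open import Data.Unit using (⊤; tt)
open import Data.Empty using (⊥-elim)
open import Data.Vec using ([]; _∷_; tabulate)
open import Data.Vec.Properties using (lookup∘tabulate; []=⇒lookup)
open import Data.Vec.Functional using (updateAt)
open import Data.Vec.Functional.Properties using (updateAt-updates; updateAt-minimal)
open import Function using (_∘_; id; const; case_of_)
open import Level using (0ℓ)
open import Relation.Binary.Definitions using (DecidableEquality)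
open import Relation.Binary.PropositionalEquality
  using (_≡_; _≢_; refl; sym; trans; cong; subst; module ≡-Reasoning)
open import Relation.Nullary using (¬_; Dec; yes; no; does; ¬?; _×-dec_)
open import Relation.Nullary.Decidable using (decidable-stable; dec-true; dec-false)
open import Relation.Unary using (Pred; Decidable)

-- Counting decidable predicates on Fin n

private
  variable
    n : ℕ
    P Q R : Pred (Fin n) 0ℓ

count : Decidable P → ℕ
count {zero}  P? = 0
count {suc n} P? = (if does (P? zero) then suc else id) (count (P? ∘ suc))

count-mono : (P? : Decidable P) (Q? : Decidable Q) → (∀ x → P x → Q x) → count P? ≤ count Q?
count-mono {zero}  P? Q? P⊆Q = z≤n
count-mono {suc n} P? Q? P⊆Q with P? zero | Q? zero
... | yes p | yes _ = s≤s (count-mono (P? ∘ suc) (Q? ∘ suc) (P⊆Q ∘ suc))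
... | yes p | no ¬q = ⊥-elim (¬q (P⊆Q zero p))
... | no _  | yes _ = m≤n⇒m≤1+n (count-mono (P? ∘ suc) (Q? ∘ suc) (P⊆Q ∘ suc))
... | no _  | no _  = count-mono (P? ∘ suc) (Q? ∘ suc) (P⊆Q ∘ suc)

count-cong : (P? : Decidable P) (Q? : Decidable Q) →
  (∀ x → P x → Q x) → (∀ x → Q x → P x) → count P? ≡ count Q?
count-cong P? Q? P⊆Q Q⊆P = ≤-antisym (count-mono P? Q? P⊆Q) (count-mono Q? P? Q⊆P)

count-cong-does : (P? : Decidable P) (Q? : Decidable Q) →
  (∀ x → does (P? x) ≡ does (Q? x)) → count P? ≡ count Q?
count-cong-does {zero}  P? Q? eq = refl
count-cong-does {suc n} P? Q? eq
  rewrite eq zero | count-cong-does (P? ∘ suc) (Q? ∘ suc) (eq ∘ suc) = refl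

count-remove : (P? : Decidable P) {x : Fin n} → P x →
  count P? ≡ suc (count (λ v → P? v ×-dec ¬? (v ≟ x)))
count-remove {suc n} P? {zero} p with P? zero
... | no ¬p = ⊥-elim (¬p p)
... | yes _ = cong suc (count-cong-does (P? ∘ suc) _ (λ v → sym (∧-identityʳ _)))
count-remove {suc n} P? {suc x} p
  rewrite count-remove (P? ∘ suc) p
        | count-cong-does (λ v → P? (suc v) ×-dec ¬? (v ≟ x))
                          (λ v → P? (suc v) ×-dec ¬? (suc v ≟ suc x)) (λ _ → refl)
  with P? zero
... | yes _ = refl
... | no _  = refl

count≤n : ∀ {n} {P : Pred (Fin n) 0ℓ} (P? : Decidable P) → count P? ≤ n
count≤n {zero}  P? = z≤n
count≤n {suc n} P? with P? zero
... | yes _ = s≤s (count≤n (P? ∘ suc))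
... | no _  = m≤n⇒m≤1+n (count≤n (P? ∘ suc))

count-none : (P? : Decidable P) → (∀ x → ¬ P x) → count P? ≡ 0
count-none {zero}  P? none = refl
count-none {suc n} P? none with P? zero
... | yes p = ⊥-elim (none zero p)
... | no _  = count-none (P? ∘ suc) (none ∘ suc)

count-complement : ∀ {n} {P : Pred (Fin n) 0ℓ} (P? : Decidable P) → count P? + count (¬? ∘ P?) ≡ n
count-complement {zero}  P? = refl
count-complement {suc n} P? with P? zero
... | yes _ = cong suc (count-complement (P? ∘ suc))
... | no _  = trans (+-suc _ _) (cong suc (count-complement (P? ∘ suc)))

count-disjoint : (P? : Decidable P) (Q? : Decidable Q) (R? : Decidable R) →
  (∀ x → P x → ¬ Q x) → (∀ x → P x → R x) → (∀ x → Q x → R x) →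
  count P? + count Q? ≤ count R?
count-disjoint {zero} P? Q? R? _ _ _ = z≤n
count-disjoint {suc n} P? Q? R? disj P⊆R Q⊆R
  with P? zero | Q? zero | R? zero
     | count-disjoint (P? ∘ suc) (Q? ∘ suc) (R? ∘ suc) (disj ∘ suc) (P⊆R ∘ suc) (Q⊆R ∘ suc)
... | yes p | yes q | _     | _  = ⊥-elim (disj zero p q)
... | yes p | no _  | no ¬r | _  = ⊥-elim (¬r (P⊆R zero p))
... | no _  | yes q | no ¬r | _  = ⊥-elim (¬r (Q⊆R zero q))
... | yes _ | no _  | yes _ | ih = s≤s ih
... | no _  | yes _ | yes _ | ih = ≤-trans (≤-reflexive (+-suc _ _)) (s≤s ih)
... | no _  | no _  | yes _ | ih = m≤n⇒m≤1+n ih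
... | no _  | no _  | no _  | ih = ih

length≤count : (P? : Decidable P) {xs : List (Fin n)} → Unique xs → All P xs →
  length xs ≤ count P?
length≤count P? [] [] = z≤n
length≤count P? {x ∷ _} (x∉xs ∷ u) (px ∷ pxs) rewrite count-remove P? px =
  s≤s (length≤count (λ v → P? v ×-dec ¬? (v ≟ x)) u
        (All.map (λ (p , x≢v) → p , x≢v ∘ sym) (All.zip (pxs , x∉xs))))

unique⇒length≤n : {xs : List (Fin n)} → Unique xs → length xs ≤ n
unique⇒length≤n u = ≤-trans (length≤count (λ _ → yes tt) u (All.universal (λ _ → tt) _)) (count≤n _)

∣p∣≡count : (p : Subset n) → ∣ p ∣ ≡ count (_∈? p)
∣p∣≡count []          = refl
∣p∣≡count (true ∷ p)  = cong suc (trans (∣p∣≡count p) (count-cong-does (_∈? p) _ λ _ → refl))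
∣p∣≡count (false ∷ p) = trans (∣p∣≡count p) (count-cong-does (_∈? p) _ λ _ → refl)

∣tabulate∣≡count : ∀ {n} {P : Pred (Fin n) 0ℓ} (P? : Decidable P) → ∣ tabulate (does ∘ P?) ∣ ≡ count P?
∣tabulate∣≡count {zero}  P? = refl
∣tabulate∣≡count {suc n} P? with P? zero
... | yes _ = cong suc (∣tabulate∣≡count (P? ∘ suc))
... | no _  = ∣tabulate∣≡count (P? ∘ suc)

∈tabulate⇒ : (P? : Decidable P) {v : Fin n} → v ∈ tabulate (does ∘ P?) → P v
∈tabulate⇒ P? {v} v∈ with P? v | trans (sym (lookup∘tabulate (does ∘ P?) v)) ([]=⇒lookup v∈)
... | yes p | _  = p
... | no _  | ()

-- One-degenerate graphs and forests

module _ {n : ℕ} (G : Graph n) where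

  adj-sym : ∀ {u v} → Adj G u v → Adj G v u
  adj-sym {u} {v} = subst T (Graph.sym G u v)

  adj⇒≢ : ∀ {u v} → Adj G u v → u ≢ v
  adj⇒≢ {u} a refl = subst T (irrefl G u) a

  AtMostOneNeighbour : Pred (Fin n) 0ℓ → Fin n → Set
  AtMostOneNeighbour P t = ∀ w₁ w₂ → P w₁ → P w₂ → Adj G t w₁ → Adj G t w₂ → w₁ ≡ w₂

  OneDegenerate : Set₁
  OneDegenerate = ∀ {P : Pred (Fin n) 0ℓ} → Decidable P → ∀ {x} → P x →
    ∃ λ t → P t × AtMostOneNeighbour P t

  TwoNeighbours : Pred (Fin n) 0ℓ → Fin n → Set
  TwoNeighbours P t = ∃₂ λ w₁ w₂ → P w₁ × P w₂ × Adj G t w₁ × Adj G t w₂ × w₁ ≢ w₂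

  atMostOne-or-two : {P : Pred (Fin n) 0ℓ} → Decidable P → ∀ t →
    AtMostOneNeighbour P t ⊎ TwoNeighbours P t
  atMostOne-or-two P? t with any? (λ w₁ → any? λ w₂ →
    P? w₁ ×-dec P? w₂ ×-dec T? (adj G t w₁) ×-dec T? (adj G t w₂) ×-dec ¬? (w₁ ≟ w₂))
  ... | yes (w₁ , w₂ , two) = inj₂ (w₁ , w₂ , two)
  ... | no ¬two = inj₁ λ w₁ w₂ p₁ p₂ a₁ a₂ → decidable-stable (w₁ ≟ w₂)
          λ w₁≢w₂ → ¬two (w₁ , w₂ , p₁ , p₂ , a₁ , a₂ , w₁≢w₂)

  walk-head : ∀ {P : Pred (Fin n) 0ℓ} {a b} → WalkIn G P a b → P a
  walk-head (here pa)     = pa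
  walk-head (step pa _ _) = pa

  walk-last : ∀ {P : Pred (Fin n) 0ℓ} {a b} → WalkIn G P a b → P b
  walk-last (here pb)    = pb
  walk-last (step _ _ w) = walk-last w

  walk-map : ∀ {P Q : Pred (Fin n) 0ℓ} → (∀ {x} → P x → Q x) → ∀ {a b} → WalkIn G P a b → WalkIn G Q a b
  walk-map f (here pa)       = here (f pa)
  walk-map f (step pa a~x w) = step (f pa) a~x (walk-map f w)

  module _ {P : Pred (Fin n) 0ℓ} {t : Fin n} (t-leaf : AtMostOneNeighbour P t) where

    walk-avoiding : ∀ {a b} → WalkIn G P a b → a ≢ t → b ≢ t → WalkIn G (λ s → P s × s ≢ t) a b
    detour : ∀ {a b} → P a → Adj G a t → WalkIn G P t b → a ≢ t → b ≢ t →
      WalkIn G (λ s → P s × s ≢ t) a b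

    walk-avoiding (here pa) a≢t _ = here (pa , a≢t)
    walk-avoiding (step {v = x} pa a~x w) a≢t b≢t with x ≟ t
    ... | yes refl = detour pa a~x w a≢t b≢t
    ... | no  x≢t  = step (pa , a≢t) a~x (walk-avoiding w x≢t b≢t)

    -- t has no other P-neighbour, so a walk entering t from a leaves it back to a.
    detour _ _ (here _) _ b≢t = ⊥-elim (b≢t refl)
    detour pa a~t (step {v = y} _ t~y w) _ b≢t =
      subst (λ r → WalkIn G (λ s → P s × s ≢ t) r _) (t-leaf y _ (walk-head w) pa t~y (adj-sym a~t))
        (walk-avoiding w (adj⇒≢ t~y ∘ sym) b≢t)

module _ {k : ℕ} (H : Graph k) where

  path-length≥2 : ∀ {u xs w} → Path H u xs w → u ≢ w → 2 ≤ length xs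
  path-length≥2 one                 u≢w = ⊥-elim (u≢w refl)
  path-length≥2 (cons _ one)        _   = s≤s (s≤s z≤n)
  path-length≥2 (cons _ (cons _ _)) _   = s≤s (s≤s z≤n)

  path-prefix : ∀ {u xs z w} → Path H u xs z → Unique xs → w ∈ₗ xs →
    ∃ λ ys → Path H u ys w × Unique ys × ys ⊆ xs
  path-prefix one        u          (here refl) = _ , one , u , λ m → m
  path-prefix (cons _ _) _          (here refl) = _ , one , [] ∷ [] , λ { (here refl) → here refl ; (there ()) }
  path-prefix (cons a p) (x∉xs ∷ u) (there w∈xs) with path-prefix p u w∈xs
  ... | ys , q , uys , ys⊆xs =
    _ ∷ ys , cons a q , anti-mono ys⊆xs x∉xs ∷ uys , λ { (here refl) → here refl ; (there m) → there (ys⊆xs m) }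

  chord⇒cycle : ∀ {e y ys z w} → Adj H e y → Path H y ys z → Unique (e ∷ ys) →
    w ∈ₗ ys → w ≢ y → Adj H e w → HasCycle H
  chord⇒cycle e~y p (e∉ys ∷ u) w∈ys w≢y e~w with path-prefix p u w∈ys
  ... | zs , q , uzs , zs⊆ys = _ , _ , _ ∷ zs , cons e~y q , anti-mono zs⊆ys e∉ys ∷ uzs ,
                               s≤s (path-length≥2 q (w≢y ∘ sym)) , adj-sym H e~w

  module _ (acyclic : ¬ HasCycle H) where

    off-path : ∀ {e y ys z w} → Adj H e y → Path H y ys z → Unique (e ∷ ys) →
      Adj H e w → w ≢ y → All (w ≢_) (e ∷ ys)
    off-path {ys = ys} {w = w} e~y p u e~w w≢y with Any.any? (w ≟_) ys
    ... | yes w∈ys = ⊥-elim (acyclic (chord⇒cycle e~y p u w∈ys w≢y e~w))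
    ... | no  w∉ys = (adj⇒≢ H e~w ∘ sym) ∷ ¬Any⇒All¬ ys w∉ys

    fresh-neighbour : ∀ {P e xs z} → Path H e xs z → Unique xs → TwoNeighbours H P e →
      ∃ λ w → P w × Adj H e w × All (w ≢_) xs
    fresh-neighbour one _ (w₁ , _ , p₁ , _ , a₁ , _) = w₁ , p₁ , a₁ , (adj⇒≢ H a₁ ∘ sym) ∷ []
    fresh-neighbour (cons {v = y} e~y p) u (w₁ , w₂ , p₁ , p₂ , a₁ , a₂ , w₁≢w₂) with w₁ ≟ y
    ... | yes refl = w₂ , p₂ , a₂ , off-path e~y p u a₂ (w₁≢w₂ ∘ sym)
    ... | no  w₁≢y = w₁ , p₁ , a₁ , off-path e~y p u a₁ w₁≢y

    leaf-by-path-extension : ∀ {P} → Decidable P → ∀ fuel {e xs z} → Path H e xs z → Unique xs → P e →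
      k ≤ fuel + length xs → ∃ λ t → P t × AtMostOneNeighbour H P t
    leaf-by-path-extension P? fuel {e} p u pe bound with atMostOne-or-two H P? e
    ... | inj₁ leaf = e , pe , leaf
    ... | inj₂ two with fresh-neighbour p u two | fuel
    ... | w , _  , _   , w∉xs | zero     = ⊥-elim (1+n≰n (≤-trans (unique⇒length≤n (w∉xs ∷ u)) bound))
    ... | w , pw , e~w , w∉xs | suc fuel =
      leaf-by-path-extension P? fuel (cons (adj-sym H e~w) p) (w∉xs ∷ u) pw
        (≤-trans bound (≤-reflexive (sym (+-suc fuel _))))

  acyclic⇒oneDegenerate : ¬ HasCycle H → OneDegenerate H
  acyclic⇒oneDegenerate acyclic P? px = leaf-by-path-extension acyclic P? k one ([] ∷ []) px (m≤m+n k 1)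

-- Width-1 tree decompositions

module _ {n : ℕ} {G : Graph n} (D : TreeDecomposition G 1) where
  open TreeDecomposition D

  Node : Set
  Node = Fin (suc m)

  module _ (U : Pred (Fin n) 0ℓ) where

    record SubDecomposition (W : Pred Node 0ℓ) : Set where
      field
        vertex-cover : ∀ {v} → U v → ∃ λ t → W t × v ∈ bag t
        edge-cover   : ∀ {u v} → U u → U v → Adj G u v → ∃ λ t → W t × u ∈ bag t × v ∈ bag t
        connected    : ∀ {v t₁ t₂} → U v → W t₁ → W t₂ → v ∈ bag t₁ → v ∈ bag t₂ →
                       WalkIn tree (λ s → W s × v ∈ bag s) t₁ t₂

    Shared : Pred Node 0ℓ → Node → Fin n → Set
    Shared W t v = ∃ λ s → W s × Adj tree t s × v ∈ bag s

    module _ {W : Pred Node 0ℓ} (S : SubDecomposition W) where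
      open SubDecomposition S

      unshared⇒neighbour∈bag : ∀ {v t w} → U v → W t → v ∈ bag t → ¬ Shared W t v →
        U w → Adj G v w → w ∈ bag t
      unshared⇒neighbour∈bag uv wt vt ¬shared uw v~w with edge-cover uv uw v~w
      ... | s , ws , vs , w∈s = subst (λ r → _ ∈ bag r) (stays (connected uv wt ws vt vs)) w∈s
        where
        stays : ∀ {s} → WalkIn tree (λ r → W r × _ ∈ bag r) _ s → s ≡ _
        stays (here _)       = refl
        stays (step _ t~r w) = ⊥-elim (¬shared (_ , proj₁ (walk-head tree w) , t~r , proj₂ (walk-head tree w)))

      unshared⇒atMostOneNeighbour : ∀ {v t} → U v → W t → v ∈ bag t → ¬ Shared W t v →
        AtMostOneNeighbour G U v
      unshared⇒atMostOneNeighbour {v} {t} uv wt vt ¬shared w₁ w₂ u₁ u₂ v~w₁ v~w₂ =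
        decidable-stable (w₁ ≟ w₂) λ w₁≢w₂ → 1+n≰n (≤-trans
          (length≤count (_∈? bag t) ((adj⇒≢ G v~w₁ ∷ adj⇒≢ G v~w₂ ∷ []) ∷ (w₁≢w₂ ∷ []) ∷ [] ∷ [])
            (vt ∷ in-bag u₁ v~w₁ ∷ in-bag u₂ v~w₂ ∷ []))
          (subst (_≤ 2) (∣p∣≡count (bag t)) (width≤ t)))
        where
        in-bag : ∀ {w} → U w → Adj G v w → w ∈ bag t
        in-bag = unshared⇒neighbour∈bag uv wt vt ¬shared

      remove-leaf : ∀ {t} → AtMostOneNeighbour tree W t → (∀ {v} → U v → v ∈ bag t → Shared W t v) →
        SubDecomposition (λ s → W s × s ≢ t)
      remove-leaf {t} t-leaf shared = record
        { vertex-cover = vertex-cover′ ; edge-cover = edge-cover′ ; connected = connected′ }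
        where
        other : ∀ {s} → Adj tree t s → s ≢ t
        other t~s = adj⇒≢ tree t~s ∘ sym

        vertex-cover′ : ∀ {v} → U v → ∃ λ s → (W s × s ≢ t) × v ∈ bag s
        vertex-cover′ uv with vertex-cover uv
        ... | s , ws , vs with s ≟ t
        ... | no s≢t = s , (ws , s≢t) , vs
        ... | yes refl with shared uv vs
        ...   | r , wr , t~r , vr = r , (wr , other t~r) , vr

        edge-cover′ : ∀ {u v} → U u → U v → Adj G u v → ∃ λ s → (W s × s ≢ t) × u ∈ bag s × v ∈ bag s
        edge-cover′ uu uv u~v with edge-cover uu uv u~v
        ... | s , ws , us , vs with s ≟ t
        ... | no s≢t = s , (ws , s≢t) , us , vs
        ... | yes refl with shared uu us | shared uv vs
        ...   | r , wr , t~r , ur | r′ , wr′ , t~r′ , vr′ =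
          r , (wr , other t~r) , ur , subst (λ x → _ ∈ bag x) (sym (t-leaf r r′ wr wr′ t~r t~r′)) vr′

        connected′ : ∀ {v t₁ t₂} → U v → W t₁ × t₁ ≢ t → W t₂ × t₂ ≢ t → v ∈ bag t₁ → v ∈ bag t₂ →
                     WalkIn tree (λ s → (W s × s ≢ t) × v ∈ bag s) t₁ t₂
        connected′ uv (w₁ , t₁≢t) (w₂ , t₂≢t) v₁ v₂ =
          walk-map tree (λ ((ws , vs) , s≢t) → (ws , s≢t) , vs)
            (walk-avoiding tree (λ r r′ p p′ → t-leaf r r′ (proj₁ p) (proj₁ p′))
              (connected uv w₁ w₂ v₁ v₂) t₁≢t t₂≢t)

    module _ (U? : Decidable U) where

      shared? : {W : Pred Node 0ℓ} → Decidable W → ∀ t v → Dec (Shared W t v)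
      shared? W? t v = any? λ s → W? s ×-dec T? (adj tree t s) ×-dec v ∈? bag s

      leaf-by-pruning : ∀ fuel {W} (W? : Decidable W) → count W? ≤ fuel → SubDecomposition W →
        ∀ {x} → U x → ∃ λ u → U u × AtMostOneNeighbour G U u
      leaf-by-pruning fuel {W} W? bound S ux with SubDecomposition.vertex-cover S ux
      ... | t₀ , wt₀ , _ with acyclic⇒oneDegenerate tree (proj₂ isTree) W? wt₀
      ... | t , wt , t-leaf with any? (λ v → U? v ×-dec v ∈? bag t ×-dec ¬? (shared? W? t v))
      ... | yes (v , uv , vt , ¬shared) = v , uv , unshared⇒atMostOneNeighbour S uv wt vt ¬shared
      ... | no ¬unshared with fuel | subst (_≤ fuel) (count-remove W? wt) bound
      ...   | zero     | ()
      ...   | suc fuel | bound′ =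
        leaf-by-pruning fuel (λ s → W? s ×-dec ¬? (s ≟ t)) (≤-pred bound′) (remove-leaf S t-leaf shared) ux
        where
        shared : ∀ {v} → U v → v ∈ bag t → Shared W t v
        shared {v} uv vt = decidable-stable (shared? W? t v) λ ¬sh → ¬unshared (v , uv , vt , ¬sh)

treewidth≤1⇒oneDegenerate : ∀ {n} {G : Graph n} → TreeDecomposition G 1 → OneDegenerate G
treewidth≤1⇒oneDegenerate {G = G} D {U} U? ux =
  leaf-by-pruning D U U? (suc m) (λ _ → yes tt) (count≤n (λ _ → yes tt)) whole ux
  where
  open TreeDecomposition D
  whole : SubDecomposition D U (λ _ → ⊤)
  whole = record
    { vertex-cover = λ {v} _ → let (t , vt) = cover v in t , tt , vt
    ; edge-cover   = λ {u} {v} _ _ u~v → let (t , ut , vt) = edgeCov u v u~v in t , tt , ut , vt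
    ; connected    = λ {v} {t₁} {t₂} _ _ _ v₁ v₂ → walk-map tree (tt ,_) (subtree v t₁ t₂ v₁ v₂) }

-- Clustered sets

module _ {n m : ℕ} (c : ℕ) (G : Graph n) (S : Subset n) (ℓ : Fin n → Fin m)
  (label-edge : ∀ {u v} → u ∈ S → v ∈ S → Adj G u v → ℓ u ≡ ℓ v)
  (class-size : ∀ x → count (λ v → v ∈? S ×-dec ℓ v ≟ x) ≤ c) where

  walk-preserves-label : ∀ {a b} → WalkIn G (_∈ S) a b → ℓ b ≡ ℓ a
  walk-preserves-label (here _)         = refl
  walk-preserves-label (step a∈S a~x w) = trans (walk-preserves-label w) (sym (label-edge a∈S (walk-head G w) a~x))

  clustered-by-labelling : Clustered c G S
  clustered-by-labelling v _ xs unique walks =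
    ≤-trans (length≤count (λ w → w ∈? S ×-dec ℓ w ≟ ℓ v) unique
              (All.map (λ w → walk-last G w , walk-preserves-label w) walks))
            (class-size (ℓ v))

-- The greedy algorithm

data Status : Set where
  pending kept deleted : Status

_≟ˢ_ : DecidableEquality Status
pending ≟ˢ pending = yes refl
pending ≟ˢ kept    = no λ ()
pending ≟ˢ deleted = no λ ()
kept    ≟ˢ pending = no λ ()
kept    ≟ˢ kept    = yes refl
kept    ≟ˢ deleted = no λ ()
deleted ≟ˢ pending = no λ ()
deleted ≟ˢ kept    = no λ ()
deleted ≟ˢ deleted = yes refl

module _ {n : ℕ} (G : Graph n) where

  record State : Set where
    field
      status : Fin n → Status
      label  : Fin n → Fin n
  open State public

  module _ (s : State) where

    Pending Kept Deleted Closed : Pred (Fin n) 0ℓ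
    Pending v = status s v ≡ pending
    Kept    v = status s v ≡ kept
    Deleted v = status s v ≡ deleted
    Closed  v = ¬ ∃ λ w → Pending w × Adj G (label s v) w

    InClass Attached : Fin n → Pred (Fin n) 0ℓ
    InClass  x v = Kept v × label s v ≡ x
    Attached u v = Kept v × Adj G u (label s v)

    pending? : Decidable Pending
    pending? v = status s v ≟ˢ pending

    kept? : Decidable Kept
    kept? v = status s v ≟ˢ kept

    deleted? : Decidable Deleted
    deleted? v = status s v ≟ˢ deleted

    keptClosed? : Decidable (λ v → Kept v × Closed v)
    keptClosed? v = kept? v ×-dec ¬? (any? λ w → pending? w ×-dec T? (adj G (label s v) w))

    inClass? : ∀ x → Decidable (InClass x)
    inClass? x v = kept? v ×-dec label s v ≟ x

    attached? : ∀ u → Decidable (Attached u)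
    attached? u v = kept? v ×-dec T? (adj G u (label s v))

  -- A kept vertex is labelled by the root of its cluster, and only roots may still have a
  -- pending neighbour. Each deleted vertex is paid for by c kept vertices of closed clusters.
  record Invariant (c : ℕ) (s : State) : Set where
    field
      label-edge : ∀ {u v} → Kept s u → Kept s v → Adj G u v → label s u ≡ label s v
      open⇒root  : ∀ {k w} → Kept s k → Pending s w → Adj G k w → label s k ≡ k
      kept-leaf  : ∀ {k} → Kept s k → AtMostOneNeighbour G (Pending s) k
      label-kept : ∀ {v} → Kept s v → Kept s (label s v)
      class-size : ∀ x → count (inClass? s x) ≤ c
      charge     : c * count (deleted? s) ≤ count (keptClosed? s)

  module Step {c : ℕ} (s : State) (inv : Invariant c s) {u : Fin n} (pu : Pending s u)
              (u-leaf : AtMostOneNeighbour G (Pending s) u) where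
    open Invariant inv

    ≢pending⇒≢u : ∀ {v σ} → status s v ≡ σ → σ ≢ pending → v ≢ u
    ≢pending⇒≢u sv σ≢p refl = σ≢p (trans (sym sv) pu)

    update : Status → Fin n → Status
    update σ = updateAt (status s) u (const σ)

    update-self : ∀ {σ} → update σ u ≡ σ
    update-self = updateAt-updates u (status s)

    update⁺ : ∀ {σ τ v} → τ ≢ pending → status s v ≡ τ → update σ v ≡ τ
    update⁺ {v = v} τ≢p sv = trans (updateAt-minimal v u (status s) (≢pending⇒≢u sv τ≢p)) sv

    update-other⁻ : ∀ {σ τ v} → v ≢ u → update σ v ≡ τ → status s v ≡ τ
    update-other⁻ {v = v} v≢u = trans (sym (updateAt-minimal v u (status s) v≢u))

    update-cases : ∀ {σ τ v} → update σ v ≡ τ → (v ≡ u × σ ≡ τ) ⊎ (v ≢ u × status s v ≡ τ)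
    update-cases {v = v} eq with v ≟ u
    ... | yes refl = inj₁ (refl , trans (sym update-self) eq)
    ... | no  v≢u  = inj₂ (v≢u , update-other⁻ v≢u eq)

    update⁻ : ∀ {σ τ v} → σ ≢ τ → update σ v ≡ τ → status s v ≡ τ
    update⁻ σ≢τ eq with update-cases eq
    ... | inj₁ (_ , σ≡τ) = ⊥-elim (σ≢τ σ≡τ)
    ... | inj₂ (_ , sv)  = sv

    pending-shrinks : ∀ {σ w} → σ ≢ pending → update σ w ≡ pending → Pending s w × w ≢ u
    pending-shrinks σ≢p eq with update-cases eq
    ... | inj₁ (_ , σ≡p)   = ⊥-elim (σ≢p σ≡p)
    ... | inj₂ (w≢u , pw) = pw , w≢u

    leaf-shrinks : ∀ {σ k} → σ ≢ pending → AtMostOneNeighbour G (Pending s) k →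
      AtMostOneNeighbour G (λ w → update σ w ≡ pending) k
    leaf-shrinks σ≢p k-leaf w₁ w₂ p₁ p₂ =
      k-leaf w₁ w₂ (proj₁ (pending-shrinks σ≢p p₁)) (proj₁ (pending-shrinks σ≢p p₂))

    attached⇒¬closed : ∀ {v} → Attached s u v → ¬ Closed s v
    attached⇒¬closed (_ , u~ℓv) closed = closed (u , pu , adj-sym G u~ℓv)

    kept-neighbour⇒attached : ∀ {k} → Kept s k → Adj G u k → Attached s u k
    kept-neighbour⇒attached kk u~k = kk , subst (Adj G u) (sym (open⇒root kk pu (adj-sym G u~k))) u~k

    retarget : Fin n → Fin n
    retarget x = if adj G u x then u else x

    retarget-adj : ∀ {x} → Adj G u x → retarget x ≡ u
    retarget-adj {x} u~x with adj G u x
    ... | true = refl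

    retarget-¬adj : ∀ {x} → ¬ Adj G u x → retarget x ≡ x
    retarget-¬adj {x} ¬u~x with adj G u x
    ... | true  = ⊥-elim (¬u~x tt)
    ... | false = refl

    relabel : Fin n → Fin n
    relabel v = if does (v ≟ u) then u else retarget (label s v)

    relabel-self : relabel u ≡ u
    relabel-self rewrite dec-true (u ≟ u) refl = refl

    relabel-other : ∀ {v} → v ≢ u → relabel v ≡ retarget (label s v)
    relabel-other {v} v≢u rewrite dec-false (v ≟ u) v≢u = refl

    attached⇒relabel≡u : ∀ {v} → Attached s u v → relabel v ≡ u
    attached⇒relabel≡u (kv , u~ℓv) = trans (relabel-other (≢pending⇒≢u kv λ ())) (retarget-adj u~ℓv)

    detached⇒relabel≡label : ∀ {v} → Kept s v → ¬ Adj G u (label s v) → relabel v ≡ label s v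
    detached⇒relabel≡label kv ¬u~ℓv = trans (relabel-other (≢pending⇒≢u kv λ ())) (retarget-¬adj ¬u~ℓv)

    keep : State
    keep = record { status = update kept ; label = relabel }

    kept-after-keep : ∀ {v} → Kept keep v → v ≡ u ⊎ Kept s v
    kept-after-keep eq with update-cases eq
    ... | inj₁ (v≡u , _) = inj₁ v≡u
    ... | inj₂ (_ , kv)  = inj₂ kv

    keep-label-edge : ∀ {x y} → Kept keep x → Kept keep y → Adj G x y → relabel x ≡ relabel y
    keep-label-edge {x} {y} kx ky x~y with kept-after-keep kx | kept-after-keep ky
    ... | inj₁ refl | inj₁ refl = ⊥-elim (adj⇒≢ G x~y refl)
    ... | inj₁ refl | inj₂ ky   =
      trans relabel-self (sym (attached⇒relabel≡u (kept-neighbour⇒attached ky x~y)))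
    ... | inj₂ kx   | inj₁ refl =
      trans (attached⇒relabel≡u (kept-neighbour⇒attached kx (adj-sym G x~y))) (sym relabel-self)
    ... | inj₂ kx   | inj₂ ky   = begin
      relabel x            ≡⟨ relabel-other (≢pending⇒≢u kx λ ()) ⟩
      retarget (label s x) ≡⟨ cong retarget (label-edge kx ky x~y) ⟩
      retarget (label s y) ≡⟨ relabel-other (≢pending⇒≢u ky λ ()) ⟨
      relabel y            ∎
      where open ≡-Reasoning

    keep-open⇒root : ∀ {k w} → Kept keep k → Pending keep w → Adj G k w → relabel k ≡ k
    keep-open⇒root {k} kk pw k~w with kept-after-keep kk | pending-shrinks (λ ()) pw
    ... | inj₁ refl | _         = relabel-self
    ... | inj₂ kk   | pw , w≢u = trans (detached⇒relabel≡label kk ¬u~ℓk) root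
      where
      root : label s k ≡ k
      root = open⇒root kk pw k~w
      ¬u~ℓk : ¬ Adj G u (label s k)
      ¬u~ℓk u~ℓk = w≢u (kept-leaf kk _ _ pw pu k~w (adj-sym G (subst (Adj G u) root u~ℓk)))

    keep-kept-leaf : ∀ {k} → Kept keep k → AtMostOneNeighbour G (Pending keep) k
    keep-kept-leaf kk with kept-after-keep kk
    ... | inj₁ refl = leaf-shrinks (λ ()) u-leaf
    ... | inj₂ kk   = leaf-shrinks (λ ()) (kept-leaf kk)

    keep-label-kept : ∀ {v} → Kept keep v → Kept keep (relabel v)
    keep-label-kept kv with kept-after-keep kv
    ... | inj₁ refl = subst (Kept keep) (sym relabel-self) update-self
    ... | inj₂ kv with T? (adj G u (label s _))
    ...   | yes u~ℓv = subst (Kept keep) (sym (attached⇒relabel≡u (kv , u~ℓv))) update-self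
    ...   | no ¬u~ℓv = subst (Kept keep) (sym (detached⇒relabel≡label kv ¬u~ℓv)) (update⁺ (λ ()) (label-kept kv))

    joins-u⇒attached : ∀ {v} → InClass keep u v → v ≢ u → Attached s u v
    joins-u⇒attached (kv′ , joins) v≢u with kept-after-keep kv′
    ... | inj₁ v≡u = ⊥-elim (v≢u v≡u)
    ... | inj₂ kv with T? (adj G u (label s _))
    ...   | yes u~ℓv = kv , u~ℓv
    ...   | no ¬u~ℓv = ⊥-elim (≢pending⇒≢u (label-kept kv) (λ ())
                                (trans (sym (detached⇒relabel≡label kv ¬u~ℓv)) joins))

    class-preserved : ∀ {x v} → x ≢ u → InClass keep x v → InClass s x v
    class-preserved x≢u (kv′ , joins) with kept-after-keep kv′
    ... | inj₁ refl = ⊥-elim (x≢u (trans (sym joins) relabel-self))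
    ... | inj₂ kv with T? (adj G u (label s _))
    ...   | yes u~ℓv = ⊥-elim (x≢u (trans (sym joins) (attached⇒relabel≡u (kv , u~ℓv))))
    ...   | no ¬u~ℓv = kv , trans (sym (detached⇒relabel≡label kv ¬u~ℓv)) joins

    keep-class-size : suc (count (attached? s u)) ≤ c → ∀ x → count (inClass? keep x) ≤ c
    keep-class-size room x with x ≟ u
    ... | no x≢u   = ≤-trans (count-mono (inClass? keep x) (inClass? s x) λ _ → class-preserved x≢u) (class-size x)
    ... | yes refl = begin
      count (inClass? keep u)
        ≡⟨ count-remove (inClass? keep u) (update-self , relabel-self) ⟩
      suc (count (λ v → inClass? keep u v ×-dec ¬? (v ≟ u)))
        ≤⟨ s≤s (count-mono _ (attached? s u) λ _ (j , v≢u) → joins-u⇒attached j v≢u) ⟩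
      suc (count (attached? s u))
        ≤⟨ room ⟩
      c ∎
      where open ≤-Reasoning

    closed-survives-keep : ∀ {v} → Kept s v × Closed s v → Kept keep v × Closed keep v
    closed-survives-keep {v} (kv , closed) = update⁺ (λ ()) kv , closed′
      where
      same-label : relabel v ≡ label s v
      same-label = detached⇒relabel≡label kv λ u~ℓv → attached⇒¬closed (kv , u~ℓv) closed
      closed′ : Closed keep v
      closed′ (w , pw , ℓv~w) =
        closed (w , proj₁ (pending-shrinks (λ ()) pw) , subst (λ z → Adj G z w) same-label ℓv~w)

    keep-charge : c * count (deleted? keep) ≤ count (keptClosed? keep)
    keep-charge = begin
      c * count (deleted? keep) ≡⟨ cong (c *_) (count-cong (deleted? keep) (deleted? s)
                                                             (λ _ → update⁻ λ ()) (λ _ → update⁺ λ ())) ⟩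
      c * count (deleted? s)    ≤⟨ charge ⟩
      count (keptClosed? s)     ≤⟨ count-mono (keptClosed? s) (keptClosed? keep) (λ _ → closed-survives-keep) ⟩
      count (keptClosed? keep)  ∎
      where open ≤-Reasoning

    keep-invariant : suc (count (attached? s u)) ≤ c → Invariant c keep
    keep-invariant room = record
      { label-edge = keep-label-edge
      ; open⇒root  = keep-open⇒root
      ; kept-leaf  = keep-kept-leaf
      ; label-kept = keep-label-kept
      ; class-size = keep-class-size room
      ; charge     = keep-charge }

    delete : State
    delete = record { status = update deleted ; label = label s }

    delete-count : count (deleted? delete) ≡ suc (count (deleted? s))
    delete-count = trans (count-remove (deleted? delete) update-self)
      (cong suc (count-cong _ (deleted? s) (λ _ (dv , v≢u) → update-other⁻ v≢u dv)
                                           (λ _ dv → update⁺ (λ ()) dv , ≢pending⇒≢u dv λ ())))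

    closed-survives-delete : ∀ {v} → Kept s v × Closed s v → Kept delete v × Closed delete v
    closed-survives-delete (kv , closed) =
      update⁺ (λ ()) kv , λ (w , pw , ℓv~w) → closed (w , proj₁ (pending-shrinks (λ ()) pw) , ℓv~w)

    -- u was the only pending neighbour of the root of an attached cluster.
    attached-closes : ∀ {v} → Attached s u v → Kept delete v × Closed delete v
    attached-closes (kv , u~ℓv) = update⁺ (λ ()) kv , λ (w , pw , ℓv~w) →
      let pw₀ , w≢u = pending-shrinks (λ ()) pw
      in w≢u (kept-leaf (label-kept kv) w u pw₀ pu ℓv~w (adj-sym G u~ℓv))

    delete-charge : c ≤ count (attached? s u) → c * count (deleted? delete) ≤ count (keptClosed? delete)
    delete-charge full = begin
      c * count (deleted? delete)                    ≡⟨ cong (c *_) delete-count ⟩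
      c * suc (count (deleted? s))                   ≡⟨ *-suc c _ ⟩
      c + c * count (deleted? s)                     ≤⟨ +-mono-≤ full charge ⟩
      count (attached? s u) + count (keptClosed? s)  ≤⟨ count-disjoint (attached? s u) (keptClosed? s) (keptClosed? delete)
                                                          (λ _ att (_ , closed) → attached⇒¬closed att closed)
                                                          (λ _ → attached-closes) (λ _ → closed-survives-delete) ⟩
      count (keptClosed? delete)                     ∎
      where open ≤-Reasoning

    delete-invariant : c ≤ count (attached? s u) → Invariant c delete
    delete-invariant full = record
      { label-edge = λ kx ky → label-edge (update⁻ (λ ()) kx) (update⁻ (λ ()) ky)
      ; open⇒root  = λ kk pw → open⇒root (update⁻ (λ ()) kk) (proj₁ (pending-shrinks (λ ()) pw))
      ; kept-leaf  = λ kk → leaf-shrinks (λ ()) (kept-leaf (update⁻ (λ ()) kk))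
      ; label-kept = λ kv → update⁺ (λ ()) (label-kept (update⁻ (λ ()) kv))
      ; class-size = λ x → ≤-trans (count-mono (inClass? delete x) (inClass? s x)
                                               λ _ (kv , eq) → update⁻ (λ ()) kv , eq)
                                   (class-size x)
      ; charge     = delete-charge full }

    pending-decreases : ∀ {σ} → σ ≢ pending →
      count (λ w → update σ w ≟ˢ pending) ≤ count (λ v → pending? s v ×-dec ¬? (v ≟ u))
    pending-decreases σ≢p =
      count-mono (λ w → update _ w ≟ˢ pending) (λ v → pending? s v ×-dec ¬? (v ≟ u)) λ _ → pending-shrinks σ≢p

    next : ∀ {fuel} → count (λ v → pending? s v ×-dec ¬? (v ≟ u)) ≤ fuel →
      ∃ λ s′ → count (pending? s′) ≤ fuel × Invariant c s′
    next bound with suc (count (attached? s u)) ≤? c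
    ... | yes room = keep   , ≤-trans (pending-decreases λ ()) bound , keep-invariant room
    ... | no  full = delete , ≤-trans (pending-decreases λ ()) bound , delete-invariant (≤-pred (≰⇒> full))

weighted-bound : ∀ c k d n → k + d ≡ n → c * d ≤ k → c * n ≤ (1 + c) * k
weighted-bound c k d n k+d≡n cd≤k = begin
  c * n         ≡⟨ cong (c *_) (sym k+d≡n) ⟩
  c * (k + d)   ≡⟨ *-distribˡ-+ c k d ⟩
  c * k + c * d ≤⟨ +-monoʳ-≤ (c * k) cd≤k ⟩
  c * k + k     ≡⟨ +-comm (c * k) k ⟩
  (1 + c) * k   ∎
  where open ≤-Reasoning

module _ {n : ℕ} (G : Graph n) (c : ℕ) (one-degenerate : OneDegenerate G) where

  LargeClusteredSet : Set
  LargeClusteredSet = Σ (Subset n) λ S → Clustered c G S × c * n ≤ (1 + c) * ∣ S ∣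

  finished⇒largeClusteredSet : ∀ s → Invariant G c s → (∀ v → ¬ Pending G s v) → LargeClusteredSet
  finished⇒largeClusteredSet s inv none = S , clustered , bound
    where
    open Invariant inv
    S : Subset n
    S = tabulate (does ∘ kept? G s)

    ∈S⇒kept : ∀ {v} → v ∈ S → Kept G s v
    ∈S⇒kept = ∈tabulate⇒ (kept? G s)

    clustered : Clustered c G S
    clustered = clustered-by-labelling c G S (label s)
      (λ u∈S v∈S → label-edge (∈S⇒kept u∈S) (∈S⇒kept v∈S))
      (λ x → ≤-trans (count-mono _ (inClass? G s x) λ _ (v∈S , eq) → ∈S⇒kept v∈S , eq) (class-size x))

    ¬kept⇒deleted : ∀ v → ¬ Kept G s v → Deleted G s v
    ¬kept⇒deleted v ¬kv with status s v in eq
    ... | pending = ⊥-elim (none v eq)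
    ... | kept    = ⊥-elim (¬kv refl)
    ... | deleted = refl

    kept+deleted : count (kept? G s) + count (deleted? G s) ≡ n
    kept+deleted = trans
      (cong (count (kept? G s) +_)
        (count-cong (deleted? G s) (¬? ∘ kept? G s) (λ _ dv kv → case trans (sym dv) kv of λ ()) ¬kept⇒deleted))
      (count-complement (kept? G s))

    bound : c * n ≤ (1 + c) * ∣ S ∣
    bound rewrite ∣tabulate∣≡count (kept? G s) =
      weighted-bound c _ _ n kept+deleted (≤-trans charge (count-mono (keptClosed? G s) (kept? G s) λ _ → proj₁))

  greedy : ∀ fuel s → count (pending? G s) ≤ fuel → Invariant G c s → LargeClusteredSet
  greedy fuel s bound inv with any? (pending? G s)
  ... | no none = finished⇒largeClusteredSet s inv λ v pv → none (v , pv)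
  ... | yes (_ , px) with one-degenerate (pending? G s) px
  ... | u , pu , u-leaf with fuel | subst (_≤ fuel) (count-remove (pending? G s) pu) bound
  ...   | zero     | ()
  ...   | suc fuel | bound′ with Step.next G s inv pu u-leaf (≤-pred bound′)
  ...     | s′ , bound″ , inv′ = greedy fuel s′ bound″ inv′

  initial : State G
  initial = record { status = const pending ; label = id }

  initial-invariant : Invariant G c initial
  initial-invariant = record
    { label-edge = λ ()
    ; open⇒root  = λ ()
    ; kept-leaf  = λ ()
    ; label-kept = λ ()
    ; class-size = λ x → ≤-trans (≤-reflexive (count-none (inClass? G initial x) λ { _ (() , _) })) z≤n
    ; charge     = ≤-trans (≤-reflexive no-charge) z≤n }
    where
    no-charge : c * count (deleted? G initial) ≡ 0
    no-charge = trans (cong (c *_) (count-none (deleted? G initial) λ _ ())) (*-zeroʳ c)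

  oneDegenerate⇒largeClusteredSet : LargeClusteredSet
  oneDegenerate⇒largeClusteredSet = greedy n initial (count≤n (pending? G initial)) initial-invariant

proposition9 : (c : ℕ) → 1 ≤ c → (n : ℕ) → (G : Graph n) → Treewidth1 G →
    Σ (Subset n) (λ S → Clustered c G S × c * n ≤ (1 + c) * ∣ S ∣)
-- The greedy argument works for every c.
proposition9 c _ n G (decomposition , _) =
  oneDegenerate⇒largeClusteredSet G c (treewidth≤1⇒oneDegenerate decomposition)
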